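{- Let $p > 5$ be a prime such that the residues of $2!, 3!, \dots, (p-1)!$ modulo $p$ are pairwise distinct. Let $k$ be an integer with $1 \le k \le p-2$, and let $!^k p = (0!)^k + (1!)^k + \cdots + ((p-1)!)^k$. Then: if $k$ is odd, $(!^k p - 2)^2 + 1 \equiv 0 \pmod p$; if $k = 4t$ for some integer $t$, $!^k p \equiv 1 \pmod p$; if $k = 4t+2$ for some integer $t$, $!^k p \equiv 3 \pmod p$.
   Context: For positive integers $n,k$, the generalized left factorial is $!^k n = (0!)^k + (1!)^k + \cdots + ((n-1)!)^k$. -}

module Defs where

open import Data.Nat using (ℕ; zero; suc; _+_; _^_; _!)


leftFact : ℕ → ℕ → ℕ
leftFact k zero    = 0
leftFact k (suc n) = leftFact k n + (n !) ^ k

-- The residues of 2!, …, (p-1)! are p-2 distinct nonzero residues, so they are all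
-- nonzero residues but one, e. For 1 ≤ k ≤ p-2 the power sum ∑ x^k over the nonzero residues vanishes
-- (Pascal's recurrence for power sums), hence !^k p = 1 + 1 + ∑_{j=2}^{p-1} (j!)^k ≡ 2 - e^k.
-- Taking products instead, (p-1)! ≡ e · 2!⋯(p-1)! = e · sf(p-2) · (p-1)! with sf(m) = 1!⋯m!, so
-- e · sf(p-2) ≡ 1. Reversing one factor of sf(p-2)² pairs j! with (p-1-j)!; these products alternate
-- in sign and start at (p-1)!, which is ±1 because inversion permutes the units. So e² ≡ ±1, and
-- e² ≡ 1 is impossible: it gives e ≡ ±(p-1)!, i.e. e ≡ (p-1)! or e ≡ (p-2)!. With e² ≡ -1 the
-- three cases are the values of e^k for k odd, k = 4t and k = 4t+2.

module Submission where

open import Data.Nat as ℕ using (ℕ; zero; suc; _+_; _*_; _^_; _∸_; _≤_; _<_; s≤s; z≤n; _!)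
open import Data.Nat.Properties
  using ( +-comm; +-identityʳ; +-cancelʳ-≡; *-comm; *-zeroʳ; *-identityˡ; *-identityʳ
        ; *-distribˡ-+; *-distribʳ-+; ^-zeroˡ; n<1+n; n≤1+n; <-trans; ≤-<-trans; <⇒≱; <⇒≢; ≤-pred
        ; ≤-total; ≤-antisym; suc-injective; 1+n≢n; m≢1+n+m; n≢0⇒n>0; suc-pred
        ; suc[m]≤n⇒m≤pred[n]; m≤pred[n]⇒suc[m]≤n; m∸n≡0⇒m≤n; m∸n≤m; m+n∸n≡m; +-∸-assoc; m∸n+n≡m )
open import Data.Nat.Induction using (<-rec)
open import Data.Nat.Divisibility as ℕ∣ using (∣m+n∣m⇒∣n; m∣m*n; n∣m*n; ∣⇒≤; >⇒∤; m%n≡0⇒n∣m)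
open import Data.Nat.DivMod using (_%_; _/_; m≡m%n+[m/n]*n; m%n<n)
open import Data.Nat.Combinatorics
  using (_C_; nCn≡1; nC1≡n; nCk≡nC[n∸k]; k>n⇒nCk≡0; nCk+nC[k+1]≡[n+1]C[k+1])
open import Data.Nat.Primality using (Prime; euclidsLemma; prime⇒nonZero; prime⇒nonTrivial)
open import Data.Nat.GCD using (module Bézout)
open import Data.Nat.Coprimality using (coprime-Bézout; prime⇒coprime)
open import Data.Nat.ListAction using (sum; product)
open import Data.Nat.ListAction.Properties using (sum-++; product-++; sum-↭; product-↭)
open import Data.Nat.Tactic.RingSolver using (solve-∀)
open import Data.List using (List; []; _∷_; _++_; _∷ʳ_; length; applyUpTo; map)
open import Data.List.Properties
  using (applyUpTo-∷ʳ; length-++; ++-identityʳ; length-applyUpTo; map-applyUpTo)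
open import Data.List.Membership.Propositional using (_∈_; _∉_; find; lose)
open import Data.List.Membership.Propositional.Properties using (∈-∃++; ∈-applyUpTo⁺; ∈-applyUpTo⁻)
open import Data.List.Relation.Binary.Subset.Propositional using (_⊆_)
open import Data.List.Relation.Binary.Permutation.Propositional
  using (_↭_; prep; ↭-sym; ↭-trans; ↭-reflexive; ↭⇒↭ₛ)
open import Data.List.Relation.Binary.Permutation.Propositional.Properties
  using (shift; ∈-resp-↭; ↭-length; map⁺)
import Data.List.Relation.Binary.Permutation.Setoid.Properties as ↭ₛ
open import Data.List.Relation.Unary.All as All using ()
open import Data.List.Relation.Unary.Any using (here; there; any?)
open import Data.List.Relation.Unary.Unique.Propositional using (Unique; []; _∷_)
open import Data.List.Relation.Unary.Unique.Propositional.Properties using (applyUpTo⁺₁; Unique[x∷xs]⇒x∉xs)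
open import Data.Product using (∃-syntax; _,_; _×_; proj₁; proj₂)
open import Data.Sum using (_⊎_; inj₁; inj₂; [_,_]′)
open import Function using (_∘_)
open import Relation.Binary.Bundles using (Setoid)
import Relation.Binary.Reasoning.Setoid as SetoidReasoning
open import Relation.Binary.PropositionalEquality
open import Relation.Nullary using (¬_; Dec; yes; no; contradiction)
import Relation.Nullary.Decidable as Dec
open import Defs using (leftFact)

∑< ∏< : ℕ → (ℕ → ℕ) → ℕ
∑< n f = sum (applyUpTo f n)
∏< n f = product (applyUpTo f n)

infixl 10 ∑< ∏<
syntax ∑< n (λ i → e) = ∑[ i < n ] e
syntax ∏< n (λ i → e) = ∏[ i < n ] e

∑-snoc : ∀ n f → ∑< (suc n) f ≡ ∑< n f + f n
∑-snoc n f = begin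
  sum (applyUpTo f (suc n))          ≡⟨ cong sum (applyUpTo-∷ʳ f n) ⟨
  sum (applyUpTo f n ∷ʳ f n)         ≡⟨ sum-++ (applyUpTo f n) _ ⟩
  ∑< n f + (f n + 0)                 ≡⟨ cong (∑< n f +_) (+-identityʳ (f n)) ⟩
  ∑< n f + f n                       ∎
  where open ≡-Reasoning

∑-cong : ∀ n {f g} → (∀ {i} → i < n → f i ≡ g i) → ∑< n f ≡ ∑< n g
∑-cong zero    f≡g = refl
∑-cong (suc n) f≡g = cong₂ _+_ (f≡g (s≤s z≤n)) (∑-cong n (f≡g ∘ s≤s))

∑-distrib-+ : ∀ n f g → ∑[ i < n ] (f i + g i) ≡ ∑< n f + ∑< n g
∑-distrib-+ zero    f g = refl
∑-distrib-+ (suc n) f g = begin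
  f 0 + g 0 + ∑[ i < n ] (f (suc i) + g (suc i))
    ≡⟨ cong (f 0 + g 0 +_) (∑-distrib-+ n (f ∘ suc) (g ∘ suc)) ⟩
  f 0 + g 0 + (∑< n (f ∘ suc) + ∑< n (g ∘ suc))
    ≡⟨ interchange (f 0) (g 0) _ _ ⟩
  f 0 + ∑< n (f ∘ suc) + (g 0 + ∑< n (g ∘ suc))
    ∎
  where
  open ≡-Reasoning
  interchange : ∀ a b c d → a + b + (c + d) ≡ a + c + (b + d)
  interchange = solve-∀

∑-distribˡ-* : ∀ n c f → ∑[ i < n ] (c * f i) ≡ c * ∑< n f
∑-distribˡ-* zero    c f = sym (*-zeroʳ c)
∑-distribˡ-* (suc n) c f =
  trans (cong (c * f 0 +_) (∑-distribˡ-* n c (f ∘ suc))) (sym (*-distribˡ-+ c (f 0) _))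

∑-zero : ∀ n → ∑[ i < n ] 0 ≡ 0
∑-zero zero    = refl
∑-zero (suc n) = ∑-zero n

∑-comm : ∀ m n (f : ℕ → ℕ → ℕ) → ∑[ i < m ] ∑[ j < n ] f i j ≡ ∑[ j < n ] ∑[ i < m ] f i j
∑-comm zero    n f = sym (∑-zero n)
∑-comm (suc m) n f = begin
  ∑< n (f 0) + ∑[ i < m ] ∑[ j < n ] f (suc i) j
    ≡⟨ cong (∑< n (f 0) +_) (∑-comm m n (f ∘ suc)) ⟩
  ∑< n (f 0) + ∑[ j < n ] ∑[ i < m ] f (suc i) j
    ≡⟨ ∑-distrib-+ n (f 0) (λ j → ∑[ i < m ] f (suc i) j) ⟨
  ∑[ j < n ] ∑[ i < suc m ] f i j
    ∎
  where open ≡-Reasoning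

∑-∣ : ∀ {d} n f → (∀ {i} → i < n → d ℕ∣.∣ f i) → d ℕ∣.∣ ∑< n f
∑-∣ zero    f d∣f = ℕ∣._∣0 _
∑-∣ (suc n) f d∣f = ℕ∣.∣m∣n⇒∣m+n (d∣f (s≤s z≤n)) (∑-∣ n (f ∘ suc) (d∣f ∘ s≤s))

binomial : ∀ x n → (1 + x) ^ n ≡ ∑[ j < suc n ] ((n C j) * x ^ j)
binomial x zero    = refl
binomial x (suc n) = begin
  (1 + x) * (1 + x) ^ n
    ≡⟨ cong ((1 + x) *_) (binomial x n) ⟩
  (1 + x) * ∑< (suc n) T
    ≡⟨ cong (∑< (suc n) T +_) (∑-distribˡ-* (suc n) x T) ⟨
  ∑< (suc n) T + ∑[ j < suc n ] (x * T j)
    ≡⟨ cong₂ _+_ lowered (∑-cong (suc n) (λ {j} _ → x*[c*y]≡c*[x*y] x (n C j) (x ^ j))) ⟩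
  1 + B + A
    ≡⟨ rearrange A B ⟩
  1 + (A + B)
    ≡⟨ cong (1 +_) (∑-distrib-+ (suc n) (λ j → (n C j) * x ^ suc j) (λ j → (n C suc j) * x ^ suc j)) ⟨
  1 + ∑[ j < suc n ] ((n C j) * x ^ suc j + (n C suc j) * x ^ suc j)
    ≡⟨ cong (1 +_) (∑-cong (suc n) (λ {j} _ → pascal j)) ⟩
  ∑[ j < suc (suc n) ] ((suc n C j) * x ^ j)
    ∎
  where
  open ≡-Reasoning
  T = λ j → (n C j) * x ^ j
  A = ∑[ j < suc n ] ((n C j) * x ^ suc j)
  B = ∑[ j < suc n ] ((n C suc j) * x ^ suc j)
  x*[c*y]≡c*[x*y] : ∀ x c y → x * (c * y) ≡ c * (x * y)
  x*[c*y]≡c*[x*y] = solve-∀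
  rearrange : ∀ a b → 1 + b + a ≡ 1 + (a + b)
  rearrange = solve-∀
  lowered : ∑< (suc n) T ≡ 1 + B
  lowered = cong (1 +_) (begin
    ∑[ j < n ] ((n C suc j) * x ^ suc j)
      ≡⟨ +-identityʳ _ ⟨
    ∑[ j < n ] ((n C suc j) * x ^ suc j) + 0 * x ^ suc n
      ≡⟨ cong (λ c → ∑[ j < n ] ((n C suc j) * x ^ suc j) + c * x ^ suc n) (k>n⇒nCk≡0 (n<1+n n)) ⟨
    ∑[ j < n ] ((n C suc j) * x ^ suc j) + (n C suc n) * x ^ suc n
      ≡⟨ ∑-snoc n (λ j → (n C suc j) * x ^ suc j) ⟨
    B ∎)
  pascal : ∀ j → (n C j) * x ^ suc j + (n C suc j) * x ^ suc j ≡ (suc n C suc j) * x ^ suc j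
  pascal j = trans (sym (*-distribʳ-+ (x ^ suc j) (n C j) _))
                   (cong (_* x ^ suc j) (nCk+nC[k+1]≡[n+1]C[k+1] n j))

powerSum : ℕ → ℕ → ℕ
powerSum q k = ∑[ x < q ] (x ^ k)

[1+n]Cn≡1+n : ∀ n → suc n C n ≡ suc n
[1+n]Cn≡1+n n = begin
  suc n C n            ≡⟨ nCk≡nC[n∸k] (n≤1+n n) ⟩
  suc n C (suc n ∸ n)  ≡⟨ cong (suc n C_) (m+n∸n≡m 1 n) ⟩
  suc n C 1            ≡⟨ nC1≡n (suc n) ⟩
  suc n                ∎
  where open ≡-Reasoning

-- Telescoping ∑[ x < q ] ((1 + x) ^ (m + 1) − x ^ (m + 1)) = q ^ (m + 1), expanded binomially.
powerSum-recurrence : ∀ q m → ∑[ j < suc m ] ((suc m C j) * powerSum q j) ≡ q ^ suc m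
powerSum-recurrence q m = +-cancelʳ-≡ (powerSum q (suc m)) _ _ (begin
  X + powerSum q (suc m)
    ≡⟨ cong (X +_) (*-identityˡ _) ⟨
  X + 1 * powerSum q (suc m)
    ≡⟨ cong (λ c → X + c * powerSum q (suc m)) (nCn≡1 (suc m)) ⟨
  X + (suc m C suc m) * powerSum q (suc m)
    ≡⟨ ∑-snoc (suc m) (λ j → (suc m C j) * powerSum q j) ⟨
  ∑[ j < suc (suc m) ] ((suc m C j) * powerSum q j)
    ≡⟨ ∑-cong (suc (suc m)) (λ {j} _ → ∑-distribˡ-* q (suc m C j) (_^ j)) ⟨
  ∑[ j < suc (suc m) ] ∑[ x < q ] ((suc m C j) * x ^ j)
    ≡⟨ ∑-comm q (suc (suc m)) (λ x j → (suc m C j) * x ^ j) ⟨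
  ∑[ x < q ] ∑[ j < suc (suc m) ] ((suc m C j) * x ^ j)
    ≡⟨ ∑-cong q (λ {x} _ → binomial x (suc m)) ⟨
  powerSum (suc q) (suc m)
    ≡⟨ ∑-snoc q (λ x → x ^ suc m) ⟩
  powerSum q (suc m) + q ^ suc m
    ≡⟨ +-comm (powerSum q (suc m)) _ ⟩
  q ^ suc m + powerSum q (suc m)
    ∎)
  where
  open ≡-Reasoning
  X = ∑[ j < suc m ] ((suc m C j) * powerSum q j)

prime∣powerSum : ∀ {p} → Prime p → ∀ j → suc j < p → p ℕ∣.∣ powerSum p j
prime∣powerSum {p} p-prime = <-rec (λ j → suc j < p → p ℕ∣.∣ powerSum p j) step
  where
  step : ∀ j → (∀ {i} → i < j → suc i < p → p ℕ∣.∣ powerSum p i) → suc j < p → p ℕ∣.∣ powerSum p j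
  step j earlier j<p with euclidsLemma (suc j) (powerSum p j) p-prime last-term
    where
    lower = ∑[ i < j ] ((suc j C i) * powerSum p i)
    recurrence : lower + suc j * powerSum p j ≡ p ^ suc j
    recurrence = trans (cong (λ c → lower + c * powerSum p j) (sym ([1+n]Cn≡1+n j)))
                       (trans (sym (∑-snoc j _)) (powerSum-recurrence p j))
    lower-divisible : p ℕ∣.∣ lower
    lower-divisible = ∑-∣ j _ (λ {i} i<j → ℕ∣.∣n⇒∣m*n (suc j C i) (earlier i<j (<-trans (s≤s i<j) j<p)))
    last-term : p ℕ∣.∣ suc j * powerSum p j
    last-term = ∣m+n∣m⇒∣n (subst (p ℕ∣.∣_) (sym recurrence) (m∣m*n _)) lower-divisible
  ... | inj₁ p∣1+j = contradiction (∣⇒≤ p∣1+j) (<⇒≱ j<p)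
  ... | inj₂ p∣sum = p∣sum

∏-snoc : ∀ n f → ∏< (suc n) f ≡ ∏< n f * f n
∏-snoc n f = begin
  product (applyUpTo f (suc n))   ≡⟨ cong product (applyUpTo-∷ʳ f n) ⟨
  product (applyUpTo f n ∷ʳ f n)  ≡⟨ product-++ (applyUpTo f n) _ ⟩
  ∏< n f * (f n * 1)              ≡⟨ cong (∏< n f *_) (*-identityʳ (f n)) ⟩
  ∏< n f * f n                    ∎
  where open ≡-Reasoning

∏-cong : ∀ n {f g} → (∀ {i} → i < n → f i ≡ g i) → ∏< n f ≡ ∏< n g
∏-cong zero    f≡g = refl
∏-cong (suc n) f≡g = cong₂ _*_ (f≡g (s≤s z≤n)) (∏-cong n (f≡g ∘ s≤s))

∏-distrib-* : ∀ n f g → ∏[ i < n ] (f i * g i) ≡ ∏< n f * ∏< n g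
∏-distrib-* zero    f g = refl
∏-distrib-* (suc n) f g =
  trans (cong (f 0 * g 0 *_) (∏-distrib-* n (f ∘ suc) (g ∘ suc))) (interchange (f 0) (g 0) _ _)
  where
  interchange : ∀ a b c d → a * b * (c * d) ≡ a * c * (b * d)
  interchange = solve-∀

∏-reverse : ∀ n f → ∏[ i < n ] f (n ∸ suc i) ≡ ∏< n f
∏-reverse zero    f = refl
∏-reverse (suc n) f =
  trans (cong (f n *_) (∏-reverse n f)) (trans (*-comm (f n) _) (sym (∏-snoc n f)))

∏-one : ∀ n → ∏[ i < n ] 1 ≡ 1
∏-one zero    = refl
∏-one (suc n) = trans (+-identityʳ _) (∏-one n)

superfactorial : ℕ → ℕ
superfactorial m = ∏[ i < m ] (suc i !)

superfactorial² : ∀ m → superfactorial m * superfactorial m ≡ ∏[ i < m ] (suc i ! * (m ∸ i) !)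
superfactorial² m = begin
  superfactorial m * superfactorial m
    ≡⟨ cong (superfactorial m *_) (∏-reverse m (λ i → suc i !)) ⟨
  superfactorial m * ∏[ i < m ] (suc (m ∸ suc i) !)
    ≡⟨ ∏-distrib-* m (λ i → suc i !) (λ i → suc (m ∸ suc i) !) ⟨
  ∏[ i < m ] (suc i ! * suc (m ∸ suc i) !)
    ≡⟨ ∏-cong m (λ {i} i<m → cong (λ r → suc i ! * r !) (+-∸-assoc 1 i<m)) ⟨
  ∏[ i < m ] (suc i ! * (m ∸ i) !)
    ∎
  where open ≡-Reasoning

∏-suc≡! : ∀ n → ∏[ i < n ] suc i ≡ n !
∏-suc≡! zero    = refl
∏-suc≡! (suc n) = trans (∏-snoc n suc) (trans (cong (_* suc n) (∏-suc≡! n)) (*-comm (n !) (suc n)))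

module _ {a} {A : Set a} where

  ∈-drop : ∀ {x y : A} xs ys → y ∈ xs ++ x ∷ ys → y ≢ x → y ∈ xs ++ ys
  ∈-drop {x} xs ys y∈ y≢x with ∈-resp-↭ (shift x xs ys) y∈
  ... | here y≡x = contradiction y≡x y≢x
  ... | there y∈′ = y∈′

  ⊆-complement : ∀ {xs ys : List A} → Unique xs → xs ⊆ ys → ∃[ zs ] ys ↭ zs ++ xs
  ⊆-complement {[]}     {ys} _            _   = ys , ↭-reflexive (sym (++-identityʳ ys))
  ⊆-complement {x ∷ xs} {ys} (x∉xs ∷ !xs) xs⊆ys
    with before , after , refl ← ∈-∃++ (xs⊆ys (here refl))
    with zs , rest↭ ← ⊆-complement !xs
                         (λ y∈xs → ∈-drop before after (xs⊆ys (there y∈xs)) (≢-sym (All.lookup x∉xs y∈xs)))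
    = zs , ↭-trans (shift x before after) (↭-trans (prep x rest↭) (↭-sym (shift x zs xs)))

  ⊆∧length≡⇒↭ : ∀ {xs ys : List A} → Unique xs → xs ⊆ ys → length xs ≡ length ys → ys ↭ xs
  ⊆∧length≡⇒↭ {xs} !xs xs⊆ys len with ⊆-complement !xs xs⊆ys
  ... | [] , ys↭xs = ys↭xs
  ... | _ ∷ zs , ys↭ =
    contradiction (trans len (trans (↭-length ys↭) (cong suc (length-++ zs)))) (m≢1+n+m (length xs))

  ⊆∧1+length≡⇒↭∷ : ∀ {xs ys : List A} → Unique xs → xs ⊆ ys → suc (length xs) ≡ length ys → ∃[ e ] ys ↭ e ∷ xs
  ⊆∧1+length≡⇒↭∷ {xs} !xs xs⊆ys len with ⊆-complement !xs xs⊆ys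
  ... | [] , ys↭xs = contradiction (trans len (↭-length ys↭xs)) 1+n≢n
  ... | e ∷ [] , ys↭ = e , ys↭
  ... | _ ∷ _ ∷ zs , ys↭ =
    contradiction (suc-injective (trans len (trans (↭-length ys↭) (cong (suc ∘ suc) (length-++ zs)))))
                  (m≢1+n+m (length xs))

∣∧<⇒≡0 : ∀ {d m} → d ℕ∣.∣ m → m < d → m ≡ 0
∣∧<⇒≡0 {m = zero}  _   _   = refl
∣∧<⇒≡0 {m = suc _} d∣m m<d = contradiction d∣m (>⇒∤ m<d)

-- Imported only here: ℤ's prefix +_ makes the ℕ sections (x +_) above ambiguous.
open import Data.Integer as ℤ using (ℤ; +_; -_; _-_; 0ℤ; 1ℤ; -1ℤ)
  renaming (_+_ to _+ℤ_; _*_ to _*ℤ_; _^_ to _^ℤ_)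
open import Data.Integer.Properties as ℤₚ using (pos-+; pos-*; m-n≡m⊖n; ∣⊖∣-≤; abs-*; neg-distribˡ-*)
open import Data.Integer.DivMod using (_%ℕ_; _/ℕ_; a≡a%ℕn+[a/ℕn]*n; n%ℕd<d)
open import Data.Integer.Divisibility using (_∣_)
import Data.Integer.Divisibility.Signed as Signed
import Data.Integer.Tactic.RingSolver as ℤ-Solver

pos-^ : ∀ a k → + (a ^ k) ≡ (+ a) ^ℤ k
pos-^ a zero    = refl
pos-^ a (suc k) = trans (pos-* a (a ^ k)) (cong (+ a *ℤ_) (pos-^ a k))

module Congruence (n : ℕ) where

  infix 4 _≈_ _≈?_
  record _≈_ (a b : ℤ) : Set where
    constructor ∣⇒≈
    field ≈⇒∣ : + n ∣ (a - b)
  open _≈_ public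

  private
    ≈-via : ∀ {a b d} → d ≡ a - b → + n Signed.∣ d → a ≈ b
    ≈-via eq n∣d = ∣⇒≈ (Signed.∣⇒∣ᵤ (subst (+ n Signed.∣_) eq n∣d))

    signed : ∀ {a b} → a ≈ b → + n Signed.∣ (a - b)
    signed = Signed.∣ᵤ⇒∣ ∘ ≈⇒∣

  ≈-intro : ∀ {a b} q → a - b ≡ q *ℤ + n → a ≈ b
  ≈-intro q eq = ≈-via refl (Signed.divides q eq)

  ≈-refl : ∀ {a} → a ≈ a
  ≈-refl {a} = ≈-intro 0ℤ (a-a≡0*n a (+ n))
    where
    a-a≡0*n : ∀ a n → a - a ≡ 0ℤ *ℤ n
    a-a≡0*n = ℤ-Solver.solve-∀

  ≈-reflexive : ∀ {a b} → a ≡ b → a ≈ b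
  ≈-reflexive refl = ≈-refl

  ≈-sym : ∀ {a b} → a ≈ b → b ≈ a
  ≈-sym {a} {b} a≈b = ≈-via (negated a b) (Signed.∣m⇒∣-m (signed a≈b))
    where
    negated : ∀ a b → - (a - b) ≡ b - a
    negated = ℤ-Solver.solve-∀

  ≈-trans : ∀ {a b c} → a ≈ b → b ≈ c → a ≈ c
  ≈-trans {a} {b} {c} a≈b b≈c = ≈-via (telescope a b c) (Signed.∣m∣n⇒∣m+n (signed a≈b) (signed b≈c))
    where
    telescope : ∀ a b c → (a - b) +ℤ (b - c) ≡ a - c
    telescope = ℤ-Solver.solve-∀

  ≈-setoid : Setoid _ _
  ≈-setoid = record
    { Carrier = ℤ ; _≈_ = _≈_
    ; isEquivalence = record { refl = ≈-refl ; sym = ≈-sym ; trans = ≈-trans } }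

  module ≈-Reasoning = SetoidReasoning ≈-setoid

  _≈?_ : ∀ a b → Dec (a ≈ b)
  a ≈? b = Dec.map′ ∣⇒≈ ≈⇒∣ (n ℕ∣.∣? ℤ.∣ a - b ∣)

  +-cong : ∀ {a b c d} → a ≈ c → b ≈ d → a +ℤ b ≈ c +ℤ d
  +-cong {a} {b} {c} {d} a≈c b≈d = ≈-via (regroup a b c d) (Signed.∣m∣n⇒∣m+n (signed a≈c) (signed b≈d))
    where
    regroup : ∀ a b c d → (a - c) +ℤ (b - d) ≡ (a +ℤ b) - (c +ℤ d)
    regroup = ℤ-Solver.solve-∀

  *-cong : ∀ {a b c d} → a ≈ c → b ≈ d → a *ℤ b ≈ c *ℤ d
  *-cong {a} {b} {c} {d} a≈c b≈d =
    ≈-via (regroup a b c d) (Signed.∣m∣n⇒∣m+n (Signed.∣m⇒∣m*n b (signed a≈c)) (Signed.∣n⇒∣m*n c (signed b≈d)))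
    where
    regroup : ∀ a b c d → (a - c) *ℤ b +ℤ c *ℤ (b - d) ≡ a *ℤ b - c *ℤ d
    regroup = ℤ-Solver.solve-∀

  +-congˡ : ∀ a {b c} → b ≈ c → a +ℤ b ≈ a +ℤ c
  +-congˡ a = +-cong (≈-refl {a})

  *-congˡ : ∀ a {b c} → b ≈ c → a *ℤ b ≈ a *ℤ c
  *-congˡ a = *-cong (≈-refl {a})

  -‿cong : ∀ {a b} → a ≈ b → - a ≈ - b
  -‿cong {a} {b} a≈b = ≈-via (negated a b) (Signed.∣m⇒∣-m (signed a≈b))
    where
    negated : ∀ a b → - (a - b) ≡ - a - - b
    negated = ℤ-Solver.solve-∀

  ^-cong : ∀ {a b} k → a ≈ b → a ^ℤ k ≈ b ^ℤ k
  ^-cong zero    a≈b = ≈-refl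
  ^-cong (suc k) a≈b = *-cong a≈b (^-cong k a≈b)

  +-multiple : ∀ a q → a +ℤ q *ℤ + n ≈ a
  +-multiple a q = ≈-intro q (difference a q (+ n))
    where
    difference : ∀ a q n → a +ℤ q *ℤ n - a ≡ q *ℤ n
    difference = ℤ-Solver.solve-∀

  %-≈ : ∀ x .{{_ : ℕ.NonZero n}} → + (x % n) ≈ + x
  %-≈ x = ≈-sym (subst (_≈ + (x % n)) (sym cast) (+-multiple (+ (x % n)) (+ (x / n))))
    where
    cast : + x ≡ + (x % n) +ℤ + (x / n) *ℤ + n
    cast = trans (cong +_ (m≡m%n+[m/n]*n x n))
                 (trans (pos-+ (x % n) _) (cong (+ (x % n) +ℤ_) (pos-* (x / n) n)))

  private
    ≈⇒≡-ordered : ∀ {a b} → a ≤ b → b < n → + a ≈ + b → a ≡ b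
    ≈⇒≡-ordered {a} {b} a≤b b<n a≈b =
      ≤-antisym a≤b (m∸n≡0⇒m≤n (∣∧<⇒≡0 n∣b∸a (≤-<-trans (m∸n≤m b a) b<n)))
      where
      n∣b∸a : n ℕ∣.∣ b ∸ a
      n∣b∸a = subst (n ℕ∣.∣_) (trans (cong ℤ.∣_∣ (m-n≡m⊖n a b)) (∣⊖∣-≤ a≤b)) (≈⇒∣ a≈b)

  ≈⇒≡ : ∀ {a b} → a < n → b < n → + a ≈ + b → a ≡ b
  ≈⇒≡ {a} {b} a<n b<n a≈b with ≤-total a b
  ... | inj₁ a≤b = ≈⇒≡-ordered a≤b b<n a≈b
  ... | inj₂ b≤a = sym (≈⇒≡-ordered b≤a a<n (≈-sym a≈b))

  ∑-cong-≈ : ∀ m {f g} → (∀ {i} → i < m → + f i ≈ + g i) → + ∑< m f ≈ + ∑< m g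
  ∑-cong-≈ zero    f≈g = ≈-refl
  ∑-cong-≈ (suc m) {f} {g} f≈g = begin
    + (f 0 + ∑< m (f ∘ suc))          ≡⟨ pos-+ (f 0) _ ⟩
    + f 0 +ℤ + ∑< m (f ∘ suc)         ≈⟨ +-cong (f≈g (s≤s z≤n)) (∑-cong-≈ m (f≈g ∘ s≤s)) ⟩
    + g 0 +ℤ + ∑< m (g ∘ suc)         ≡⟨ pos-+ (g 0) _ ⟨
    + (g 0 + ∑< m (g ∘ suc))          ∎
    where open ≈-Reasoning

  ∏-cong-≈ : ∀ m {f g} → (∀ {i} → i < m → + f i ≈ + g i) → + ∏< m f ≈ + ∏< m g
  ∏-cong-≈ zero    f≈g = ≈-refl
  ∏-cong-≈ (suc m) {f} {g} f≈g = begin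
    + (f 0 * ∏< m (f ∘ suc))          ≡⟨ pos-* (f 0) _ ⟩
    + f 0 *ℤ + ∏< m (f ∘ suc)         ≈⟨ *-cong (f≈g (s≤s z≤n)) (∏-cong-≈ m (f≈g ∘ s≤s)) ⟩
    + g 0 *ℤ + ∏< m (g ∘ suc)         ≡⟨ pos-* (g 0) _ ⟨
    + (g 0 * ∏< m (g ∘ suc))          ∎
    where open ≈-Reasoning

  %ℕ-≈ : ∀ c .{{_ : ℕ.NonZero n}} → + (c %ℕ n) ≈ c
  %ℕ-≈ c = ≈-sym (subst (_≈ + (c %ℕ n)) (sym (a≡a%ℕn+[a/ℕn]*n c n)) (+-multiple (+ (c %ℕ n)) (c /ℕ n)))

  ∣⇒≈0 : ∀ {x} → n ℕ∣.∣ x → + x ≈ 0ℤ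
  ∣⇒≈0 {x} n∣x = ∣⇒≈ (subst (n ℕ∣.∣_) (sym (+-identityʳ x)) n∣x)

  *n≈0 : ∀ c → + (c * n) ≈ 0ℤ
  *n≈0 c = ∣⇒≈0 (n∣m*n c)

  +≈0⇒≈- : ∀ {a b} → a +ℤ b ≈ 0ℤ → b ≈ - a
  +≈0⇒≈- {a} {b} a+b≈0 = ≈-via (rearrange a b) (signed a+b≈0)
    where
    rearrange : ∀ a b → a +ℤ b - 0ℤ ≡ b - - a
    rearrange = ℤ-Solver.solve-∀

  %-≡⇒≈ : ∀ {x y} .{{_ : ℕ.NonZero n}} → x % n ≡ y % n → + x ≈ + y
  %-≡⇒≈ {x} {y} eq = ≈-trans (≈-sym (%-≈ x)) (≈-trans (≈-reflexive (cong +_ eq)) (%-≈ y))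

  i²≈-1⇒i^k*i^k≈[-1]^k : ∀ {i} → i *ℤ i ≈ -1ℤ → ∀ k → i ^ℤ k *ℤ i ^ℤ k ≈ -1ℤ ^ℤ k
  i²≈-1⇒i^k*i^k≈[-1]^k {i} i²≈-1 zero    = ≈-refl
  i²≈-1⇒i^k*i^k≈[-1]^k {i} i²≈-1 (suc k) = begin
    i *ℤ i ^ℤ k *ℤ (i *ℤ i ^ℤ k)      ≡⟨ interchange i (i ^ℤ k) ⟩
    i *ℤ i *ℤ (i ^ℤ k *ℤ i ^ℤ k)      ≈⟨ *-cong i²≈-1 (i²≈-1⇒i^k*i^k≈[-1]^k i²≈-1 k) ⟩
    -1ℤ *ℤ -1ℤ ^ℤ k                   ∎
    where
    open ≈-Reasoning
    interchange : ∀ a b → a *ℤ b *ℤ (a *ℤ b) ≡ a *ℤ a *ℤ (b *ℤ b)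
    interchange = ℤ-Solver.solve-∀

  infix 4 _≈±1
  _≈±1 : ℤ → Set
  a ≈±1 = a ≈ 1ℤ ⊎ a ≈ -1ℤ

  ≈±1-resp : ∀ {a b} → a ≈ b → a ≈±1 → b ≈±1
  ≈±1-resp a≈b (inj₁ a≈1)  = inj₁ (≈-trans (≈-sym a≈b) a≈1)
  ≈±1-resp a≈b (inj₂ a≈-1) = inj₂ (≈-trans (≈-sym a≈b) a≈-1)

  -‿≈±1 : ∀ {a} → a ≈±1 → - a ≈±1
  -‿≈±1 (inj₁ a≈1)  = inj₂ (-‿cong a≈1)
  -‿≈±1 (inj₂ a≈-1) = inj₁ (-‿cong a≈-1)

  *-≈±1 : ∀ {a b} → a ≈±1 → b ≈±1 → a *ℤ b ≈±1
  *-≈±1 (inj₁ a≈1)  (inj₁ b≈1)  = inj₁ (*-cong a≈1 b≈1)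
  *-≈±1 (inj₁ a≈1)  (inj₂ b≈-1) = inj₂ (*-cong a≈1 b≈-1)
  *-≈±1 (inj₂ a≈-1) (inj₁ b≈1)  = inj₂ (*-cong a≈-1 b≈1)
  *-≈±1 (inj₂ a≈-1) (inj₂ b≈-1) = inj₁ (*-cong a≈-1 b≈-1)

  ∏-≈±1 : ∀ m f → (∀ {i} → i < m → + f i ≈±1) → + ∏< m f ≈±1
  ∏-≈±1 zero    f f≈±1 = inj₁ ≈-refl
  ∏-≈±1 (suc m) f f≈±1 =
    ≈±1-resp (≈-reflexive (sym (pos-* (f 0) _))) (*-≈±1 (f≈±1 (s≤s z≤n)) (∏-≈±1 m (f ∘ suc) (f≈±1 ∘ s≤s)))

  ≈±1-cases : ∀ {a b} → a ≈±1 → b ≈±1 → a ≈ b ⊎ a ≈ - b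
  ≈±1-cases (inj₁ a≈1)  (inj₁ b≈1)  = inj₁ (≈-trans a≈1 (≈-sym b≈1))
  ≈±1-cases (inj₂ a≈-1) (inj₂ b≈-1) = inj₁ (≈-trans a≈-1 (≈-sym b≈-1))
  ≈±1-cases (inj₁ a≈1)  (inj₂ b≈-1) = inj₂ (≈-trans a≈1 (≈-sym (-‿cong b≈-1)))
  ≈±1-cases (inj₂ a≈-1) (inj₁ b≈1)  = inj₂ (≈-trans a≈-1 (≈-sym (-‿cong b≈1)))

module PrimeModulus (p : ℕ) (p-prime : Prime p) where

  open Congruence p public

  instance
    p≢0 : ℕ.NonZero p
    p≢0 = prime⇒nonZero p-prime

  1<p : 1 < p
  1<p = ℕ.nonTrivial⇒n>1 p {{prime⇒nonTrivial p-prime}}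

  p∣*⇒p∣⊎p∣ : ∀ a b → + p ∣ a *ℤ b → + p ∣ a ⊎ + p ∣ b
  p∣*⇒p∣⊎p∣ a b p∣ab = euclidsLemma ℤ.∣ a ∣ ℤ.∣ b ∣ p-prime (subst (p ℕ∣.∣_) (abs-* a b) p∣ab)

  ≈-cancelˡ : ∀ c {a b} → ¬ (+ p ∣ c) → c *ℤ a ≈ c *ℤ b → a ≈ b
  ≈-cancelˡ c {a} {b} p∤c ca≈cb with p∣*⇒p∣⊎p∣ c (a - b) (subst (+ p ∣_) (factor c a b) (≈⇒∣ ca≈cb))
    where
    factor : ∀ c a b → c *ℤ a - c *ℤ b ≡ c *ℤ (a - b)
    factor = ℤ-Solver.solve-∀
  ... | inj₁ p∣c   = contradiction p∣c p∤c
  ... | inj₂ p∣a-b = ∣⇒≈ p∣a-b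

  x²≈1⇒x≈±1 : ∀ {a} → a *ℤ a ≈ 1ℤ → a ≈±1
  x²≈1⇒x≈±1 {a} a²≈1 with p∣*⇒p∣⊎p∣ (a - 1ℤ) (a - -1ℤ) (subst (+ p ∣_) (factor a) (≈⇒∣ a²≈1))
    where
    factor : ∀ a → a *ℤ a - 1ℤ ≡ (a - 1ℤ) *ℤ (a - -1ℤ)
    factor = ℤ-Solver.solve-∀
  ... | inj₁ p∣a-1  = inj₁ (∣⇒≈ p∣a-1)
  ... | inj₂ p∣a+1  = inj₂ (∣⇒≈ p∣a+1)

  p∤! : ∀ {j} → j < p → ¬ (p ℕ∣.∣ j !)
  p∤! {zero}  _   p∣1  = <⇒≱ 1<p (∣⇒≤ p∣1)
  p∤! {suc j} j<p p∣j! with euclidsLemma (suc j) (j !) p-prime p∣j!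
  ... | inj₁ p∣1+j = <⇒≱ j<p (∣⇒≤ p∣1+j)
  ... | inj₂ p∣j!′ = p∤! (<-trans (n<1+n j) j<p) p∣j!′

  units : List ℕ
  units = applyUpTo suc (ℕ.pred p)

  ∈-units⁺ : ∀ {y} → 0 < y → y < p → y ∈ units
  ∈-units⁺ {suc y} _ y<p = ∈-applyUpTo⁺ suc (suc[m]≤n⇒m≤pred[n] y<p)

  ∈-units⁻ : ∀ {y} → y ∈ units → 0 < y × y < p
  ∈-units⁻ y∈ with i , i<p-1 , refl ← ∈-applyUpTo⁻ suc y∈ = s≤s z≤n , m≤pred[n]⇒suc[m]≤n i<p-1

  units-unique : Unique units
  units-unique = applyUpTo⁺₁ suc (ℕ.pred p) (λ i<j _ → <⇒≢ i<j ∘ suc-injective)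

  %-∈-units : ∀ {x} → ¬ (p ℕ∣.∣ x) → x % p ∈ units
  %-∈-units {x} p∤x with x % p in eq
  ... | zero  = contradiction (m%n≡0⇒n∣m x p eq) p∤x
  ... | suc r = ∈-units⁺ (s≤s z≤n) (subst (_< p) eq (m%n<n x p))

  0≉1 : ¬ (0ℤ ≈ 1ℤ)
  0≉1 0≈1 with () ← ≈⇒≡ (<-trans (n<1+n 0) 1<p) 1<p 0≈1

  private
    1+mn≡kq⇒ℤ : ∀ m n k q → 1 + m * n ≡ k * q → 1ℤ +ℤ + m *ℤ + n ≡ + k *ℤ + q
    1+mn≡kq⇒ℤ m n k q eq = begin
      1ℤ +ℤ + m *ℤ + n   ≡⟨ cong (1ℤ +ℤ_) (pos-* m n) ⟨
      + (1 + m * n)      ≡⟨ cong +_ eq ⟩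
      + (k * q)          ≡⟨ pos-* k q ⟩
      + k *ℤ + q         ∎
      where open ≡-Reasoning

  ∃-inverseℤ : ∀ {x} → x ∈ units → ∃[ c ] + x *ℤ c ≈ 1ℤ
  ∃-inverseℤ {zero}     0∈ with () ← proj₁ (∈-units⁻ 0∈)
  ∃-inverseℤ {x@(suc _)} x∈ with coprime-Bézout (prime⇒coprime p-prime (proj₂ (∈-units⁻ x∈)))
  ... | Bézout.+- a b eq = - + b , ≈-intro (- + a) (begin
        + x *ℤ (- + b) - 1ℤ        ≡⟨ rearrange (+ x) (+ b) ⟩
        - (1ℤ +ℤ + b *ℤ + x)       ≡⟨ cong -_ (1+mn≡kq⇒ℤ b x a p eq) ⟩
        - (+ a *ℤ + p)             ≡⟨ neg-distribˡ-* (+ a) (+ p) ⟩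
        - + a *ℤ + p               ∎)
    where
    open ≡-Reasoning
    rearrange : ∀ x b → x *ℤ (- b) - 1ℤ ≡ - (1ℤ +ℤ b *ℤ x)
    rearrange = ℤ-Solver.solve-∀
  ... | Bézout.-+ a b eq = + b , ≈-intro (+ a) (begin
        + x *ℤ + b - 1ℤ            ≡⟨ rearrange (+ x) (+ b) ⟩
        + b *ℤ + x - 1ℤ            ≡⟨ cong (_- 1ℤ) (1+mn≡kq⇒ℤ a p b x eq) ⟨
        1ℤ +ℤ + a *ℤ + p - 1ℤ      ≡⟨ cancel (+ a *ℤ + p) ⟩
        + a *ℤ + p                 ∎)
    where
    open ≡-Reasoning
    rearrange : ∀ x b → x *ℤ b - 1ℤ ≡ b *ℤ x - 1ℤ
    rearrange = ℤ-Solver.solve-∀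
    cancel : ∀ c → 1ℤ +ℤ c - 1ℤ ≡ c
    cancel = ℤ-Solver.solve-∀

  ∃-inverse : ∀ {x} → x ∈ units → ∃[ y ] y ∈ units × + x *ℤ + y ≈ 1ℤ
  ∃-inverse {x} x∈ with c , xc≈1 ← ∃-inverseℤ x∈ = y , ∈-units⁺ y>0 (n%ℕd<d c p) , xy≈1
    where
    y = c %ℕ p
    xy≈1 : + x *ℤ + y ≈ 1ℤ
    xy≈1 = ≈-trans (*-congˡ (+ x) (%ℕ-≈ c)) xc≈1
    y>0 : 0 < y
    y>0 = n≢0⇒n>0 (λ y≡0 → 0≉1 (≈-trans (≈-reflexive (sym (ℤₚ.*-zeroʳ (+ x))))
                                         (subst (λ z → + x *ℤ + z ≈ 1ℤ) y≡0 xy≈1)))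

  inverse : ℕ → ℕ
  inverse x with any? (λ y → + x *ℤ + y ≈? 1ℤ) units
  ... | yes found = proj₁ (find found)
  ... | no  _     = 0

  inverse-spec : ∀ {x} → x ∈ units → inverse x ∈ units × + x *ℤ + inverse x ≈ 1ℤ
  inverse-spec {x} x∈ with any? (λ y → + x *ℤ + y ≈? 1ℤ) units
  ... | yes found = proj₂ (find found)
  ... | no  none  = contradiction (lose y∈ xy≈1) none
    where
    y∈ = proj₁ (proj₂ (∃-inverse x∈))
    xy≈1 = proj₂ (proj₂ (∃-inverse x∈))

  inverse-injective : ∀ {a b} → a ∈ units → b ∈ units → inverse a ≡ inverse b → a ≡ b
  inverse-injective {a} {b} a∈ b∈ same = ≈⇒≡ (proj₂ (∈-units⁻ a∈)) (proj₂ (∈-units⁻ b∈)) (begin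
    + a                       ≈⟨ ≈-reflexive (ℤₚ.*-identityʳ (+ a)) ⟨
    + a *ℤ 1ℤ                 ≈⟨ *-congˡ (+ a) (proj₂ (inverse-spec b∈)) ⟨
    + a *ℤ (+ b *ℤ + c)       ≡⟨ swap (+ a) (+ b) (+ c) ⟩
    + b *ℤ (+ a *ℤ + c)       ≈⟨ *-congˡ (+ b) a*c≈1 ⟩
    + b *ℤ 1ℤ                 ≡⟨ ℤₚ.*-identityʳ (+ b) ⟩
    + b                       ∎)
    where
    open ≈-Reasoning
    c = inverse b
    a*c≈1 : + a *ℤ + c ≈ 1ℤ
    a*c≈1 = subst (λ y → + a *ℤ + y ≈ 1ℤ) same (proj₂ (inverse-spec a∈))
    swap : ∀ a b c → a *ℤ (b *ℤ c) ≡ b *ℤ (a *ℤ c)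
    swap = ℤ-Solver.solve-∀

  inverses : List ℕ
  inverses = applyUpTo (inverse ∘ suc) (ℕ.pred p)

  units↭inverses : units ↭ inverses
  units↭inverses = ⊆∧length≡⇒↭ unique inverses⊆units
    (trans (length-applyUpTo _ (ℕ.pred p)) (sym (length-applyUpTo suc (ℕ.pred p))))
    where
    unit : ∀ {i} → i < ℕ.pred p → suc i ∈ units
    unit = ∈-applyUpTo⁺ suc
    unique : Unique inverses
    unique = applyUpTo⁺₁ (inverse ∘ suc) (ℕ.pred p)
      (λ i<j j<p-1 same →
         <⇒≢ i<j (suc-injective (inverse-injective (unit (<-trans i<j j<p-1)) (unit j<p-1) same)))
    inverses⊆units : inverses ⊆ units
    inverses⊆units y∈ with i , i<p-1 , refl ← ∈-applyUpTo⁻ (inverse ∘ suc) y∈ =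
      proj₁ (inverse-spec (unit i<p-1))

  [p-1]!²≈1 : + (ℕ.pred p !) *ℤ + (ℕ.pred p !) ≈ 1ℤ
  [p-1]!²≈1 = begin
    + W *ℤ + W
      ≡⟨ pos-* W W ⟨
    + (W * W)
      ≡⟨ cong₂ (λ a b → + (a * b)) (sym (∏-suc≡! (ℕ.pred p))) W≡∏inverses ⟩
    + (∏[ i < ℕ.pred p ] suc i * ∏[ i < ℕ.pred p ] inverse (suc i))
      ≡⟨ cong +_ (∏-distrib-* (ℕ.pred p) suc (inverse ∘ suc)) ⟨
    + ∏[ i < ℕ.pred p ] (suc i * inverse (suc i))
      ≈⟨ ∏-cong-≈ (ℕ.pred p) unit-times-inverse ⟩
    + ∏[ i < ℕ.pred p ] 1
      ≡⟨ cong +_ (∏-one (ℕ.pred p)) ⟩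
    1ℤ
      ∎
    where
    open ≈-Reasoning
    W = ℕ.pred p !
    W≡∏inverses : W ≡ product inverses
    W≡∏inverses = trans (sym (∏-suc≡! (ℕ.pred p))) (product-↭ units↭inverses)
    unit-times-inverse : ∀ {i} → i < ℕ.pred p → + (suc i * inverse (suc i)) ≈ + 1
    unit-times-inverse {i} i<p-1 =
      ≈-trans (≈-reflexive (pos-* (suc i) _)) (proj₂ (inverse-spec (∈-applyUpTo⁺ suc i<p-1)))

  [p-1]!≈±1 : + (ℕ.pred p !) ≈±1
  [p-1]!≈±1 = x²≈1⇒x≈±1 [p-1]!²≈1

  p∣∑units^k : ∀ {k} → 1 ≤ k → suc k < p → p ℕ∣.∣ sum (map (_^ k) units)
  p∣∑units^k {suc k} _ 2+k<p = subst (p ℕ∣.∣_) (sym ∑units≡powerSum) (prime∣powerSum p-prime (suc k) 2+k<p)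
    where
    ∑units≡powerSum : sum (map (_^ suc k) units) ≡ powerSum p (suc k)
    ∑units≡powerSum = trans (cong sum (map-applyUpTo suc (_^ suc k) (ℕ.pred p)))
                            (cong (λ q → powerSum q (suc k)) (suc-pred p))

  binomialDenominator : ℕ → ℕ
  binomialDenominator j = j ! * (ℕ.pred p ∸ j) !

  binomialDenominator-+-suc : ∀ {j} → suc j < p →
    binomialDenominator j + binomialDenominator (suc j) ≡ j ! * (ℕ.pred p ∸ suc j) ! * p
  binomialDenominator-+-suc {j} 1+j<p = begin
    j ! * (ℕ.pred p ∸ j) ! + suc j ! * q !
      ≡⟨ cong (λ r → j ! * r ! + suc j ! * q !) (+-∸-assoc 1 j<p-1) ⟩
    j ! * (suc q * q !) + suc j * j ! * q !
      ≡⟨ factor (j !) (q !) q j ⟩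
    j ! * q ! * (suc q + suc j)
      ≡⟨ cong (λ r → j ! * q ! * suc r) (m∸n+n≡m j<p-1) ⟩
    j ! * q ! * suc (ℕ.pred p)
      ≡⟨ cong (j ! * q ! *_) (suc-pred p) ⟩
    j ! * q ! * p
      ∎
    where
    open ≡-Reasoning
    q = ℕ.pred p ∸ suc j
    j<p-1 : j < ℕ.pred p
    j<p-1 = suc[m]≤n⇒m≤pred[n] 1+j<p
    factor : ∀ a b q j → a * (suc q * b) + suc j * a * b ≡ a * b * (suc q + suc j)
    factor = solve-∀

  binomialDenominator-suc : ∀ {j} → suc j < p → + binomialDenominator (suc j) ≈ - + binomialDenominator j
  binomialDenominator-suc {j} 1+j<p = +≈0⇒≈- (begin
    + binomialDenominator j +ℤ + binomialDenominator (suc j)   ≡⟨ pos-+ (binomialDenominator j) _ ⟨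
    + (binomialDenominator j + binomialDenominator (suc j))    ≡⟨ cong +_ (binomialDenominator-+-suc 1+j<p) ⟩
    + (j ! * (ℕ.pred p ∸ suc j) ! * p)                         ≈⟨ *n≈0 (j ! * (ℕ.pred p ∸ suc j) !) ⟩
    0ℤ                                                         ∎)
    where open ≈-Reasoning

  binomialDenominator≈±1 : ∀ {j} → j < p → + binomialDenominator j ≈±1
  binomialDenominator≈±1 {zero}  _     = ≈±1-resp (≈-reflexive (cong +_ (sym (*-identityˡ _)))) [p-1]!≈±1
  binomialDenominator≈±1 {suc j} 1+j<p = ≈±1-resp (≈-sym (binomialDenominator-suc 1+j<p))
    (-‿≈±1 (binomialDenominator≈±1 (<-trans (n<1+n j) 1+j<p)))

leftFact≡∑ : ∀ k n → leftFact k n ≡ ∑[ j < n ] ((j !) ^ k)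
leftFact≡∑ k zero    = refl
leftFact≡∑ k (suc n) = trans (cong (_+ (n !) ^ k) (leftFact≡∑ k n)) (sym (∑-snoc n (λ j → (j !) ^ k)))

[-1]^[2t]≡1 : ∀ t → -1ℤ ^ℤ (2 * t) ≡ 1ℤ
[-1]^[2t]≡1 t = trans (sym (ℤₚ.^-*-assoc -1ℤ 2 t)) (ℤₚ.^-zeroˡ t)

[-1]^[2t+1]≡-1 : ∀ t → -1ℤ ^ℤ (2 * t + 1) ≡ -1ℤ
[-1]^[2t+1]≡-1 t = trans (ℤₚ.^-distribˡ-+-* -1ℤ (2 * t) 1) (cong (_*ℤ -1ℤ) ([-1]^[2t]≡1 t))

-- p is written 4 + n so that ℕ.pred p and p ∸ 2 compute.
module FactorialResidues (n : ℕ) (p-prime : Prime (4 + n))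
  (distinct : ∀ {i j} → 2 ≤ i → i < j → j < 4 + n → i ! % (4 + n) ≢ j ! % (4 + n)) where

  p : ℕ
  p = 4 + n

  open PrimeModulus p p-prime

  factorialResidue : ℕ → ℕ
  factorialResidue i = (2 + i) ! % p

  residues : List ℕ
  residues = applyUpTo factorialResidue (2 + n)

  residues-unique : Unique residues
  residues-unique = applyUpTo⁺₁ factorialResidue (2 + n)
    (λ i<j j<2+n → distinct (s≤s (s≤s z≤n)) (s≤s (s≤s i<j)) (s≤s (s≤s j<2+n)))

  residues⊆units : residues ⊆ units
  residues⊆units y∈ with i , i<2+n , refl ← ∈-applyUpTo⁻ factorialResidue y∈ =
    %-∈-units (p∤! (s≤s (s≤s i<2+n)))

  missing : ∃[ e ] units ↭ e ∷ residues
  missing = ⊆∧1+length≡⇒↭∷ residues-unique residues⊆units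
    (trans (cong suc (length-applyUpTo factorialResidue (2 + n))) (sym (length-applyUpTo suc (3 + n))))

  -- Opaque: unfolding e would run the whole proof of missing.
  opaque
    e : ℕ
    e = proj₁ missing

    units↭e∷residues : units ↭ e ∷ residues
    units↭e∷residues = proj₂ missing

  e≉! : ∀ {j} → 2 ≤ j → j < p → ¬ (+ e ≈ + (j !))
  e≉! {suc (suc i)} (s≤s (s≤s z≤n)) j<p e≈j! =
    e∉residues (subst (_∈ residues) (sym e≡) (∈-applyUpTo⁺ factorialResidue (≤-pred (≤-pred j<p))))
    where
    e∉residues : e ∉ residues
    e∉residues = Unique[x∷xs]⇒x∉xs (↭ₛ.Unique-resp-↭ (setoid ℕ) (↭⇒↭ₛ units↭e∷residues) units-unique)
    e<p : e < p
    e<p = proj₂ (∈-units⁻ (∈-resp-↭ (↭-sym units↭e∷residues) (here refl)))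
    e≡ : e ≡ (2 + i) ! % p
    e≡ = ≈⇒≡ e<p (m%n<n ((2 + i) !) p) (≈-trans e≈j! (≈-sym (%-≈ ((2 + i) !))))

  leftFact≈2-e^k : ∀ {k} → 1 ≤ k → k < 3 + n → + leftFact k p ≈ + 2 - (+ e) ^ℤ k
  leftFact≈2-e^k {k} 1≤k k<p-1 = begin
    + leftFact k p                                       ≡⟨ cong +_ (leftFact≡∑ k p) ⟩
    + (1 ^ k + (1 ^ k + F))                              ≡⟨ cong (λ x → + (x + (x + F))) (^-zeroˡ k) ⟩
    + (2 + F)                                            ≡⟨ pos-+ 2 F ⟩
    + 2 +ℤ + F                                           ≈⟨ +-congˡ (+ 2) F≈R ⟩
    + 2 +ℤ + R                                           ≈⟨ +-congˡ (+ 2) R≈-e^k ⟩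
    + 2 - (+ e) ^ℤ k                                     ∎
    where
    open ≈-Reasoning
    F = ∑[ i < 2 + n ] (((2 + i) !) ^ k)
    R = sum (map (_^ k) residues)
    F≈R : + F ≈ + R
    F≈R = subst (λ x → + F ≈ + x) (cong sum (sym (map-applyUpTo factorialResidue (_^ k) (2 + n))))
      (∑-cong-≈ (2 + n) (λ {i} _ →
        subst₂ _≈_ (sym (pos-^ _ k)) (sym (pos-^ _ k)) (^-cong k (≈-sym (%-≈ ((2 + i) !))))))
    ∑units≡ : sum (map (_^ k) units) ≡ e ^ k + R
    ∑units≡ = sum-↭ (map⁺ (_^ k) units↭e∷residues)
    R≈-e^k : + R ≈ - (+ e) ^ℤ k
    R≈-e^k = subst (λ x → + R ≈ - x) (pos-^ e k)
      (+≈0⇒≈- (subst (_≈ 0ℤ) (trans (cong +_ ∑units≡) (pos-+ (e ^ k) R)) (∣⇒≈0 (p∣∑units^k 1≤k (s≤s k<p-1)))))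

  private
    W sf : ℕ
    W = (3 + n) !
    sf = superfactorial (2 + n)

  superfactorial*e≈1 : + sf *ℤ + e ≈ 1ℤ
  superfactorial*e≈1 = ≈-sym (≈-cancelˡ (+ W) (p∤! (n<1+n (3 + n))) (begin
    + W *ℤ 1ℤ                              ≡⟨ ℤₚ.*-identityʳ (+ W) ⟩
    + W                                    ≡⟨ cong +_ W≡∏units ⟩
    + (e * product residues)               ≡⟨ pos-* e (product residues) ⟩
    + e *ℤ + product residues              ≈⟨ *-congˡ (+ e) residues≈factorials ⟩
    + e *ℤ + ∏[ i < 2 + n ] ((2 + i) !)     ≡⟨ cong (λ x → + e *ℤ + x) factorials≡ ⟩
    + e *ℤ + (sf * W)                      ≡⟨ cong (+ e *ℤ_) (pos-* sf W) ⟩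
    + e *ℤ (+ sf *ℤ + W)                   ≡⟨ rearrange (+ e) (+ sf) (+ W) ⟩
    + W *ℤ (+ sf *ℤ + e)                   ∎))
    where
    open ≈-Reasoning
    W≡∏units : W ≡ e * product residues
    W≡∏units = trans (sym (∏-suc≡! (3 + n))) (product-↭ units↭e∷residues)
    residues≈factorials : + product residues ≈ + ∏[ i < 2 + n ] ((2 + i) !)
    residues≈factorials = ∏-cong-≈ (2 + n) (λ {i} _ → %-≈ ((2 + i) !))
    factorials≡ : ∏[ i < 2 + n ] ((2 + i) !) ≡ sf * W
    factorials≡ = trans (sym (*-identityˡ (∏[ i < 2 + n ] ((2 + i) !)))) (∏-snoc (2 + n) (λ i → suc i !))
    rearrange : ∀ e s w → e *ℤ (s *ℤ w) ≡ w *ℤ (s *ℤ e)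
    rearrange = ℤ-Solver.solve-∀

  superfactorial²≈±1 : + sf *ℤ + sf ≈±1
  superfactorial²≈±1 = ≈±1-resp (≈-reflexive (trans (cong +_ (sym (superfactorial² (2 + n)))) (pos-* sf sf)))
    (∏-≈±1 (2 + n) (binomialDenominator ∘ suc)
      (λ i<2+n → binomialDenominator≈±1 (s≤s (<-trans i<2+n (n<1+n (2 + n))))))

  e²≉1 : ¬ (+ e *ℤ + e ≈ 1ℤ)
  e²≉1 e²≈1 = [ e≉[p-1]! , e≉-[p-1]! ]′ (≈±1-cases (x²≈1⇒x≈±1 {+ e} e²≈1) [p-1]!≈±1)
    where
    e≉[p-1]! : ¬ (+ e ≈ + (ℕ.pred p !))
    e≉[p-1]! = e≉! {ℕ.pred p} (s≤s (s≤s z≤n)) (n<1+n (3 + n))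
    [p-2]!≈-[p-1]! : + ((ℕ.pred p ∸ 1) !) ≈ - + (ℕ.pred p !)
    [p-2]!≈-[p-1]! = subst₂ (λ a b → + a ≈ - + b) (*-identityˡ ((ℕ.pred p ∸ 1) !)) (*-identityˡ (ℕ.pred p !))
                       (binomialDenominator-suc {0} (s≤s (s≤s z≤n)))
    e≉-[p-1]! : ¬ (+ e ≈ - + (ℕ.pred p !))
    e≉-[p-1]! e≈-[p-1]! = e≉! {ℕ.pred p ∸ 1} (s≤s (s≤s z≤n)) (<-trans (n<1+n (2 + n)) (n<1+n (3 + n)))
                            (≈-trans e≈-[p-1]! (≈-sym [p-2]!≈-[p-1]!))

  private
    e² = + e *ℤ + e

    sf²≈c⇒c*e²≈1 : ∀ {c} → + sf *ℤ + sf ≈ c → c *ℤ e² ≈ 1ℤ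
    sf²≈c⇒c*e²≈1 {c} sf²≈c = begin
      c *ℤ e²                       ≈⟨ *-cong (≈-sym sf²≈c) (≈-refl {e²}) ⟩
      + sf *ℤ + sf *ℤ e²            ≡⟨ interchange (+ sf) (+ e) ⟩
      + sf *ℤ + e *ℤ (+ sf *ℤ + e)  ≈⟨ *-cong superfactorial*e≈1 superfactorial*e≈1 ⟩
      1ℤ                            ∎
      where
      open ≈-Reasoning
      interchange : ∀ a b → a *ℤ a *ℤ (b *ℤ b) ≡ a *ℤ b *ℤ (a *ℤ b)
      interchange = ℤ-Solver.solve-∀

  e²≈-1 : + e *ℤ + e ≈ -1ℤ
  e²≈-1 = [ (λ sf²≈1 → contradiction (subst (_≈ 1ℤ) (ℤₚ.*-identityˡ e²) (sf²≈c⇒c*e²≈1 sf²≈1)) e²≉1)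
          , (λ sf²≈-1 → subst (_≈ -1ℤ) (ℤₚ.neg-involutive e²)
                              (-‿cong (subst (_≈ 1ℤ) (ℤₚ.-1*i≡-i e²) (sf²≈c⇒c*e²≈1 sf²≈-1))))
          ]′ superfactorial²≈±1

  e^[j+j]≈[-1]^j : ∀ j → (+ e) ^ℤ (j + j) ≈ -1ℤ ^ℤ j
  e^[j+j]≈[-1]^j j = ≈-trans (≈-reflexive (ℤₚ.^-distribˡ-+-* (+ e) j j)) (i²≈-1⇒i^k*i^k≈[-1]^k e²≈-1 j)

  module _ {k} (1≤k : 1 ≤ k) (k<p-1 : k < 3 + n) where

    private
      L a : ℤ
      L = + leftFact k p
      a = (+ e) ^ℤ k

      L≈2-a : L ≈ + 2 - a
      L≈2-a = leftFact≈2-e^k 1≤k k<p-1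

    leftFact-odd : ∀ t → k ≡ 2 * t + 1 → (L - + 2) *ℤ (L - + 2) ≈ -1ℤ
    leftFact-odd t k≡2t+1 = begin
      (L - + 2) *ℤ (L - + 2)    ≈⟨ *-cong L-2≈-a L-2≈-a ⟩
      - a *ℤ - a                ≡⟨ neg-square a ⟩
      a *ℤ a                    ≈⟨ i²≈-1⇒i^k*i^k≈[-1]^k e²≈-1 k ⟩
      -1ℤ ^ℤ k                  ≡⟨ cong (-1ℤ ^ℤ_) k≡2t+1 ⟩
      -1ℤ ^ℤ (2 * t + 1)        ≡⟨ [-1]^[2t+1]≡-1 t ⟩
      -1ℤ                       ∎
      where
      open ≈-Reasoning
      neg-square : ∀ a → - a *ℤ - a ≡ a *ℤ a
      neg-square = ℤ-Solver.solve-∀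
      cancel : ∀ a → + 2 - a - + 2 ≡ - a
      cancel = ℤ-Solver.solve-∀
      L-2≈-a : L - + 2 ≈ - a
      L-2≈-a = ≈-trans (+-cong L≈2-a (≈-refl { - + 2})) (≈-reflexive (cancel a))

    leftFact-4t : ∀ t → k ≡ 4 * t → L ≈ + 1
    leftFact-4t t k≡4t = ≈-trans L≈2-a (+-congˡ (+ 2) (-‿cong a≈1))
      where
      4t≡2t+2t : ∀ t → 4 * t ≡ 2 * t + 2 * t
      4t≡2t+2t = solve-∀
      a≈1 : a ≈ 1ℤ
      a≈1 = ≈-trans (≈-reflexive (cong ((+ e) ^ℤ_) (trans k≡4t (4t≡2t+2t t))))
                    (≈-trans (e^[j+j]≈[-1]^j (2 * t)) (≈-reflexive ([-1]^[2t]≡1 t)))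

    leftFact-4t+2 : ∀ t → k ≡ 4 * t + 2 → L ≈ + 3
    leftFact-4t+2 t k≡4t+2 = ≈-trans L≈2-a (+-congˡ (+ 2) (-‿cong a≈-1))
      where
      4t+2≡[2t+1]+[2t+1] : ∀ t → 4 * t + 2 ≡ (2 * t + 1) + (2 * t + 1)
      4t+2≡[2t+1]+[2t+1] = solve-∀
      a≈-1 : a ≈ -1ℤ
      a≈-1 = ≈-trans (≈-reflexive (cong ((+ e) ^ℤ_) (trans k≡4t+2 (4t+2≡[2t+1]+[2t+1] t))))
                     (≈-trans (e^[j+j]≈[-1]^j (2 * t + 1)) (≈-reflexive ([-1]^[2t+1]≡-1 t)))


mainTheorem2 : (p : ℕ) → Prime p → 5 < p →
    (∀ i j → 2 ≤ i → i < j → j ≤ p ∸ 1 → ¬ ((+ p) ∣ (+ (i !) - + (j !)))) →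
    (k : ℕ) → 1 ≤ k → k ≤ p ∸ 2 →
    ((∀ t → k ≡ 2 * t + 1 →
        (+ p) ∣ ((+ leftFact k p - + 2) *ℤ (+ leftFact k p - + 2) +ℤ + 1))
    × (∀ t → k ≡ 4 * t → (+ p) ∣ (+ leftFact k p - + 1))
    × (∀ t → k ≡ 4 * t + 2 → (+ p) ∣ (+ leftFact k p - + 3)))
mainTheorem2 _ p-prime (s≤s (s≤s (s≤s (s≤s (s≤s (s≤s (z≤n {m}))))))) distinct k 1≤k k≤p-2 =
    (λ t k≡2t+1 → ≈⇒∣ (leftFact-odd 1≤k (s≤s k≤p-2) t k≡2t+1))
  , (λ t k≡4t → ≈⇒∣ (leftFact-4t 1≤k (s≤s k≤p-2) t k≡4t))
  , (λ t k≡4t+2 → ≈⇒∣ (leftFact-4t+2 1≤k (s≤s k≤p-2) t k≡4t+2))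
  where
  open Congruence (6 + m) using (≈⇒∣; %-≡⇒≈)
  open FactorialResidues (2 + m) p-prime
    (λ {i} {j} 2≤i i<j j<p same → distinct i j 2≤i i<j (≤-pred j<p) (≈⇒∣ (%-≡⇒≈ {i !} {j !} same)))
    using (leftFact-odd; leftFact-4t; leftFact-4t+2)
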